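{- Let \(D\) be a \(\mathcal V\)-dcpo with a small basis. Then \(D\) is locally small. Moreover, the way-below relation on all of \(D\) has small values, i.e. \(x\ll y\) is \(\mathcal V\)-small for all \(x,y:D\).
   Context: We work constructively and predicatively in univalent foundations with universes and propositional truncation. \(\mathcal V\)-small: equivalent to a type in \(\mathcal V\). Directed family: inhabited index and any two indices have (there exists) a common upper index. \(\mathcal V\)-dcpo: poset with suprema of directed families indexed by types in \(\mathcal V\). Locally small: \(x\sqsubseteq y\) is \(\mathcal V\)-small for all \(x,y\). Way-below: \(x\ll y\) iff for every directed \(\alpha:I\to D\), \(I:\mathcal V\), with \(y\sqsubseteq\bigsqcup\alpha\) there exists \(i\) with \(x\sqsubseteq\alpha_i\). Small basis: a map \(\beta:B\to D\) with \(B:\mathcal V\) such that for every \(x:D\) the family \(\Sigma_{b:B}(\beta(b)\ll x)\to D\), \((b,-)\mapsto\beta(b)\), is directed with supremum \(x\), and each proposition \(\beta(b)\ll x\) is \(\mathcal V\)-small. -}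

module Defs where

open import Level using (Level; _⊔_; suc; Setω)
open import Data.Product using (Σ; Σ-syntax; _×_; _,_; proj₁; proj₂)
open import Relation.Binary.PropositionalEquality using (_≡_)
open import Function using (_∘_; id)

isProp : ∀ {ℓ} → Set ℓ → Set ℓ
isProp A = (x y : A) → x ≡ y

isSet : ∀ {ℓ} → Set ℓ → Set ℓ
isSet A = (x y : A) → isProp (x ≡ y)

isEquiv : ∀ {a b} {A : Set a} {B : Set b} → (A → B) → Set (a ⊔ b)
isEquiv {A = A} {B} f =
  (Σ[ g ∈ (B → A) ] ((y : B) → f (g y) ≡ y)) ×
  (Σ[ h ∈ (B → A) ] ((x : A) → h (f x) ≡ x))

_≃_ : ∀ {a b} → Set a → Set b → Set (a ⊔ b)
A ≃ B = Σ[ f ∈ (A → B) ] isEquiv f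

isSmall : ∀ {ℓ} (𝓥 : Level) → Set ℓ → Set (suc 𝓥 ⊔ ℓ)
isSmall 𝓥 A = Σ[ X ∈ Set 𝓥 ] (X ≃ A)

-- Propositional truncation, assumed as structure (as in TypeTopology)
record PropTrunc : Setω where
  field
    ∥_∥ : ∀ {ℓ} → Set ℓ → Set ℓ
    ∣_∣ : ∀ {ℓ} {A : Set ℓ} → A → ∥ A ∥
    ∥∥-isProp : ∀ {ℓ} {A : Set ℓ} → isProp ∥ A ∥
    ∥∥-rec : ∀ {ℓ ℓ'} {A : Set ℓ} {P : Set ℓ'} → isProp P → (A → P) → ∥ A ∥ → P

  ∃∥ : ∀ {ℓ ℓ'} (A : Set ℓ) → (A → Set ℓ') → Set (ℓ ⊔ ℓ')
  ∃∥ A P = ∥ Σ A P ∥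

module WithPT (pt : PropTrunc) where
  open PropTrunc pt

  isDirected : ∀ {u t i} {D : Set u} (_⊑_ : D → D → Set t) {I : Set i}
               → (I → D) → Set (t ⊔ i)
  isDirected _⊑_ {I} α =
    ∥ I ∥ × ((i j : I) → ∃∥ I (λ k → (α i ⊑ α k) × (α j ⊑ α k)))

  isSup : ∀ {u t i} {D : Set u} (_⊑_ : D → D → Set t) {I : Set i}
          → (I → D) → D → Set (u ⊔ t ⊔ i)
  isSup {D = D} _⊑_ {I} α s =
    ((i : I) → α i ⊑ s) × ((u : D) → ((i : I) → α i ⊑ u) → s ⊑ u)

  record DCPO (𝓥 𝓤 𝓣 : Level) : Set (suc (𝓥 ⊔ 𝓤 ⊔ 𝓣)) where
    field
      Carrier   : Set 𝓤
      _⊑_       : Carrier → Carrier → Set 𝓣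
      Carrier-isSet : isSet Carrier
      ⊑-isProp  : (x y : Carrier) → isProp (x ⊑ y)
      ⊑-refl    : (x : Carrier) → x ⊑ x
      ⊑-trans   : {x y z : Carrier} → x ⊑ y → y ⊑ z → x ⊑ z
      ⊑-antisym : {x y : Carrier} → x ⊑ y → y ⊑ x → x ≡ y
      ⋁         : {I : Set 𝓥} (α : I → Carrier) → isDirected _⊑_ α → Carrier
      ⋁-isSup   : {I : Set 𝓥} (α : I → Carrier) (δ : isDirected _⊑_ α)
                  → isSup _⊑_ α (⋁ α δ)

  module _ {𝓥 𝓤 𝓣 : Level} (D : DCPO 𝓥 𝓤 𝓣) where
    open DCPO D

    _≪_ : Carrier → Carrier → Set (suc 𝓥 ⊔ 𝓤 ⊔ 𝓣)
    x ≪ y = {I : Set 𝓥} (α : I → Carrier) (δ : isDirected _⊑_ α)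
            → y ⊑ ⋁ α δ → ∃∥ I (λ i → x ⊑ α i)

    isLocallySmall : Set (suc 𝓥 ⊔ 𝓤 ⊔ 𝓣)
    isLocallySmall = (x y : Carrier) → isSmall 𝓥 (x ⊑ y)

    isSmallBasis : {B : Set 𝓥} → (B → Carrier) → Set (suc 𝓥 ⊔ 𝓤 ⊔ 𝓣)
    isSmallBasis {B} β =
      (x : Carrier) →
        isDirected _⊑_ {I = Σ[ b ∈ B ] (β b ≪ x)} (β ∘ proj₁)
        × isSup _⊑_ {I = Σ[ b ∈ B ] (β b ≪ x)} (β ∘ proj₁) x
        × ((b : B) → isSmall 𝓥 (β b ≪ x))

    hasSmallBasis : Set (suc 𝓥 ⊔ 𝓤 ⊔ 𝓣)
    hasSmallBasis = Σ[ B ∈ Set 𝓥 ] Σ[ β ∈ (B → Carrier) ] isSmallBasis β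

-- Both relations can be read off the basis. Since x is the supremum of the basis
-- elements way below it, x ⊑ y iff every basis element way below x is way below y.
-- Since y is the supremum of a directed family of basis elements, x ≪ y iff some
-- basis element way below y lies above x. The right-hand sides quantify over the
-- small type B and the small copies of β b ≪ _ only, so they are small.
module Submission where

open import Defs
open import Level using (Level; Lift; lift)
open import Data.Product using (_×_; Σ; Σ-syntax; _,_; proj₁; proj₂)
open import Data.Unit using (⊤; tt)
open import Function using (_∘_)
open import Relation.Binary.PropositionalEquality using (_≡_; refl; sym; trans; cong; subst)
open import Axiom.Extensionality.Propositional using (Extensionality; implicit-extensionality)

≃-isProp : ∀ {a b} {A : Set a} {B : Set b} → A ≃ B → isProp B → isProp A
≃-isProp (f , _ , (g , g∘f≡id)) B-isProp x y =
  trans (sym (g∘f≡id x)) (trans (cong g (B-isProp (f x) (f y))) (g∘f≡id y))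

props-⇔⇒≃ : ∀ {a b} {A : Set a} {B : Set b} → isProp A → isProp B
  → (A → B) → (B → A) → A ≃ B
props-⇔⇒≃ A-isProp B-isProp f g =
  f , (g , λ _ → B-isProp _ _) , (g , λ _ → A-isProp _ _)

module DirectedFamilies (pt : PropTrunc) {𝓤 𝓣 : Level}
  {D : Set 𝓤} (_⊑_ : D → D → Set 𝓣) where
  open PropTrunc pt
  open WithPT pt

  module _ {i j} {I : Set i} {J : Set j} (α : I → D) (f : J → I) (g : I → J)
    (α∘f∘g≡α : (i : I) → α (f (g i)) ≡ α i) where

    isDirected-reindex : isDirected _⊑_ α → isDirected _⊑_ (α ∘ f)
    isDirected-reindex (inhabited , semidirected) =
        ∥∥-rec ∥∥-isProp (λ i → ∣ g i ∣) inhabited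
      , λ j j′ → ∥∥-rec ∥∥-isProp
          (λ (k , αj⊑αk , αj′⊑αk) →
             ∣ g k , subst (α (f j) ⊑_) (sym (α∘f∘g≡α k)) αj⊑αk
                   , subst (α (f j′) ⊑_) (sym (α∘f∘g≡α k)) αj′⊑αk ∣)
          (semidirected (f j) (f j′))

    isSup-reindex : {s : D} → isSup _⊑_ α s → isSup _⊑_ (α ∘ f) s
    isSup-reindex (upper , least) =
        (λ j → upper (f j))
      , λ u bound → least u λ i → subst (_⊑ u) (α∘f∘g≡α i) (bound (g i))

module WayBelow (pt : PropTrunc) (fe : ∀ a b → Extensionality a b)
  {𝓥 𝓤 𝓣 : Level} (D : WithPT.DCPO pt 𝓥 𝓤 𝓣) where
  open PropTrunc pt
  open WithPT pt
  open DCPO D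

  ≪-isProp : (x y : Carrier) → isProp (_≪_ D x y)
  ≪-isProp x y p q = implicit-extensionality (fe _ _) λ {_} →
    fe _ _ λ α → fe _ _ λ δ → fe _ _ λ y⊑⋁α → ∥∥-isProp _ _

  isSup⇒⊑⋁ : {I : Set 𝓥} (α : I → Carrier) (δ : isDirected _⊑_ α) {s : Carrier}
    → isSup _⊑_ α s → s ⊑ ⋁ α δ
  isSup⇒⊑⋁ α δ (_ , least) = least (⋁ α δ) (proj₁ (⋁-isSup α δ))

  -- Test x ≪ y against the constant family at y.
  ≪⇒⊑ : {x y : Carrier} → _≪_ D x y → x ⊑ y
  ≪⇒⊑ {x} {y} x≪y = ∥∥-rec (⊑-isProp x y) proj₂
    (x≪y constant δ (proj₁ (⋁-isSup constant δ) (lift tt)))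
    where
    constant : Lift 𝓥 ⊤ → Carrier
    constant _ = y
    δ : isDirected _⊑_ constant
    δ = ∣ lift tt ∣ , λ _ _ → ∣ lift tt , ⊑-refl y , ⊑-refl y ∣

  ⊑-≪-trans : {x y z : Carrier} → x ⊑ y → _≪_ D y z → _≪_ D x z
  ⊑-≪-trans x⊑y y≪z α δ z⊑⋁α =
    ∥∥-rec ∥∥-isProp (λ (i , y⊑αi) → ∣ i , ⊑-trans x⊑y y⊑αi ∣) (y≪z α δ z⊑⋁α)

  ≪-⊑-trans : {x y z : Carrier} → _≪_ D x y → y ⊑ z → _≪_ D x z
  ≪-⊑-trans x≪y y⊑z α δ z⊑⋁α = x≪y α δ (⊑-trans y⊑z z⊑⋁α)

  module SmallBasis {B : Set 𝓥} (β : B → Carrier) (basis : isSmallBasis D β) where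
    open DirectedFamilies pt _⊑_

    -- b ≪ᴮ x is the chosen small copy of β b ≪ x.
    _≪ᴮ_ : B → Carrier → Set 𝓥
    b ≪ᴮ x = proj₁ (proj₂ (proj₂ (basis x)) b)

    ≪ᴮ→≪ : {b : B} {x : Carrier} → b ≪ᴮ x → _≪_ D (β b) x
    ≪ᴮ→≪ {b} {x} = proj₁ (proj₂ (proj₂ (proj₂ (basis x)) b))

    ≪→≪ᴮ : {b : B} {x : Carrier} → _≪_ D (β b) x → b ≪ᴮ x
    ≪→≪ᴮ {b} {x} = proj₁ (proj₁ (proj₂ (proj₂ (proj₂ (proj₂ (basis x)) b))))

    ≪ᴮ-isProp : (b : B) (x : Carrier) → isProp (b ≪ᴮ x)
    ≪ᴮ-isProp b x = ≃-isProp (proj₂ (proj₂ (proj₂ (basis x)) b)) (≪-isProp (β b) x)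

    ↡ᴮ : Carrier → Set 𝓥
    ↡ᴮ x = Σ[ b ∈ B ] b ≪ᴮ x

    ↡ᴮ-inclusion : (x : Carrier) → ↡ᴮ x → Carrier
    ↡ᴮ-inclusion x (b , _) = β b

    ↡ᴮ→↡ : {x : Carrier} → ↡ᴮ x → Σ[ b ∈ B ] _≪_ D (β b) x
    ↡ᴮ→↡ (b , b≪ᴮx) = b , ≪ᴮ→≪ b≪ᴮx

    ↡→↡ᴮ : {x : Carrier} → Σ[ b ∈ B ] _≪_ D (β b) x → ↡ᴮ x
    ↡→↡ᴮ (b , βb≪x) = b , ≪→≪ᴮ βb≪x

    ↡ᴮ-isDirected : (x : Carrier) → isDirected _⊑_ (↡ᴮ-inclusion x)
    ↡ᴮ-isDirected x =
      isDirected-reindex (β ∘ proj₁) ↡ᴮ→↡ ↡→↡ᴮ (λ _ → refl) (proj₁ (basis x))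

    ↡ᴮ-isSup : (x : Carrier) → isSup _⊑_ (↡ᴮ-inclusion x) x
    ↡ᴮ-isSup x =
      isSup-reindex (β ∘ proj₁) ↡ᴮ→↡ ↡→↡ᴮ (λ _ → refl) (proj₁ (proj₂ (basis x)))

    _⊑ᴮ_ : Carrier → Carrier → Set 𝓥
    x ⊑ᴮ y = (b : B) → b ≪ᴮ x → b ≪ᴮ y

    ⊑ᴮ-isProp : (x y : Carrier) → isProp (x ⊑ᴮ y)
    ⊑ᴮ-isProp x y p q = fe _ _ λ b → fe _ _ λ _ → ≪ᴮ-isProp b y _ _

    ⊑ᴮ→⊑ : {x y : Carrier} → x ⊑ᴮ y → x ⊑ y
    ⊑ᴮ→⊑ {x} {y} x⊑ᴮy =
      proj₂ (↡ᴮ-isSup x) y λ (b , b≪ᴮx) → ≪⇒⊑ (≪ᴮ→≪ (x⊑ᴮy b b≪ᴮx))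

    ⊑→⊑ᴮ : {x y : Carrier} → x ⊑ y → x ⊑ᴮ y
    ⊑→⊑ᴮ x⊑y b b≪ᴮx = ≪→≪ᴮ (≪-⊑-trans (≪ᴮ→≪ b≪ᴮx) x⊑y)

    _≪ₛ_ : Carrier → Carrier → Set 𝓥
    x ≪ₛ y = ∃∥ B λ b → x ⊑ᴮ β b × b ≪ᴮ y

    ≪ₛ→≪ : {x y : Carrier} → x ≪ₛ y → _≪_ D x y
    ≪ₛ→≪ {x} {y} = ∥∥-rec (≪-isProp x y)
      λ (b , x⊑ᴮβb , b≪ᴮy) → ⊑-≪-trans (⊑ᴮ→⊑ x⊑ᴮβb) (≪ᴮ→≪ b≪ᴮy)

    ≪→≪ₛ : {x y : Carrier} → _≪_ D x y → x ≪ₛ y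
    ≪→≪ₛ {x} {y} x≪y = ∥∥-rec ∥∥-isProp
      (λ ((b , b≪ᴮy) , x⊑βb) → ∣ b , ⊑→⊑ᴮ x⊑βb , b≪ᴮy ∣)
      (x≪y (↡ᴮ-inclusion y) (↡ᴮ-isDirected y)
           (isSup⇒⊑⋁ (↡ᴮ-inclusion y) (↡ᴮ-isDirected y) (↡ᴮ-isSup y)))

    locally-small : isLocallySmall D
    locally-small x y =
      x ⊑ᴮ y , props-⇔⇒≃ (⊑ᴮ-isProp x y) (⊑-isProp x y) ⊑ᴮ→⊑ ⊑→⊑ᴮ

    ≪-small : (x y : Carrier) → isSmall 𝓥 (_≪_ D x y)
    ≪-small x y = x ≪ₛ y , props-⇔⇒≃ ∥∥-isProp (≪-isProp x y) ≪ₛ→≪ ≪→≪ₛ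

proposition5p5 : (pt : PropTrunc) → (∀ a b → Extensionality a b)
    → ∀ {𝓥 𝓤 𝓣 : Level} (D : WithPT.DCPO pt 𝓥 𝓤 𝓣)
    → WithPT.hasSmallBasis pt D
    → WithPT.isLocallySmall pt D
    × ((x y : WithPT.DCPO.Carrier D) → isSmall 𝓥 (WithPT._≪_ pt D x y))
proposition5p5 pt fe D (B , β , basis) = locally-small , ≪-small
  where open WayBelow.SmallBasis pt fe D β basis
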